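{- Let $p$ be an odd prime, $q$ a power of $p$, $l\ge0$ an integer, $n=p^l+2$, and $k$ an integer with $0\le k\le p-1$ and $k\neq 0,2,4$. Then $D_{n,k}(1,x)$ is a permutation polynomial of $\mathbb{F}_q$ if and only if the trinomial $(4-k)\,x^{\frac{p^l+1}{2}}+k\,x^{\frac{p^l-1}{2}}+(2-k)x$ is a permutation polynomial of $\mathbb{F}_q$.
   Context: For an integer $n\ge1$, $D_{n,k}(1,x)=\sum_{i=0}^{\lfloor n/2\rfloor}\frac{n-ki}{n-i}\binom{n-i}{i}(-x)^i\in\mathbb{F}_q[x]$ (the coefficients are integers, reduced mod $p$). A permutation polynomial of $\mathbb{F}_q$ is a polynomial inducing a bijection of $\mathbb{F}_q$. -}

module Defs where

open import Level using (Level; _⊔_; suc)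
open import Data.Nat as ℕ using (ℕ; zero; _∸_)
open import Data.Nat.DivMod as ℕD using ()
open import Data.Nat.Combinatorics using (_C_)
open import Data.Integer as ℤ using (ℤ; +_; -[1+_]; _/ℕ_)
open import Data.List using (List; foldr; map; upTo)
open import Data.Fin using (Fin)
open import Data.Product using (Σ; ∃; _×_; _,_)
open import Algebra.Bundles using (CommutativeRing)
open import Relation.Nullary using (¬_)

record Field (c ℓ : Level) : Set (Level.suc (c ⊔ ℓ)) where
  field
    commRing : CommutativeRing c ℓ
  open CommutativeRing commRing public
  field
    0≉1     : ¬ (0# ≈ 1#)
    inverse : ∀ x → ¬ (x ≈ 0#) → ∃ λ y → (x * y) ≈ 1#

module _ {c ℓ} (F : Field c ℓ) where
  open Field F

  natF : ℕ → Carrier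
  natF zero      = 0#
  natF (ℕ.suc n) = 1# + natF n

  intF : ℤ → Carrier
  intF (+ n)      = natF n
  intF -[1+ n ]   = - natF (ℕ.suc n)

  pow : Carrier → ℕ → Carrier
  pow x zero      = 1#
  pow x (ℕ.suc m) = x * pow x m

  HasCard : ℕ → Set (c ⊔ ℓ)
  HasCard q = Σ (Fin q → Carrier) λ e →
                (∀ i j → e i ≈ e j → i ≡ j) × (∀ y → ∃ λ i → e i ≈ y)
    where open import Relation.Binary.PropositionalEquality using (_≡_)

  HasChar : ℕ → Set ℓ
  HasChar p = natF p ≈ 0#

  IsPermutation : (Carrier → Carrier) → Set (c ⊔ ℓ)
  IsPermutation f =
    (∀ x y → f x ≈ f y → x ≈ y) × (∀ y → ∃ λ x → f x ≈ y)

  -- The integer coefficient (n - k i)/(n - i) · C(n-i, i)  (exact division)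
  Dcoeff : ℕ → ℕ → ℕ → ℤ
  Dcoeff n k i with n ∸ i
  ... | zero      = + 0
  ... | ℕ.suc m   = ((+ n ℤ.- + (k ℕ.* i)) ℤ.* + ((n ∸ i) C i)) /ℕ ℕ.suc m

  D : ℕ → ℕ → Carrier → Carrier
  D n k x = foldr _+_ 0#
              (map (λ i → intF (Dcoeff n k i) * pow (- x) i)
                   (upTo (ℕ.suc (n ℕD./ 2))))

  Trinomial : ℕ → ℕ → ℕ → Carrier → Carrier
  Trinomial p l k x =
      intF (+ 4 ℤ.- + k) * pow x ((p ℕ.^ l ℕ.+ 1) ℕD./ 2)
    + intF (+ k) * pow x ((p ℕ.^ l ∸ 1) ℕD./ 2)
    + intF (+ 2 ℤ.- + k) * x

-- Put G₀ = 0, G₁ = 1, G_{n+2} = G_{n+1} − x G_n, so that G_{n+1} = Σ C(n−i, i) (−x)^i.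
-- Comparing coefficients gives D_{n+2,k}(1,x) = G_{n+3} + (k − 1) x G_{n+1}.  With t = 1 − 4x,
-- the numbers 1 ± √t are the roots of X² − 2X + 4x, so the √t-coordinate B_n of (1 + √t)^n
-- equals 2^{n−1} G_n.  For m = p^l = 2j + 1 the Frobenius map gives (1 + √t)^m = 1 + t^j √t
-- and 2^m = 2, which turns the two values of G into powers of t:
-- 8 D_{m+2,k}(1,x) = T(1 − 4x) + (k + 2), T the trinomial.  As p is odd, x ↦ 1 − 4x and
-- y ↦ 8y − (k + 2) are bijections of F, so D_{m+2,k}(1,·) permutes F exactly when T does.

module Submission where

open import Defs
open import Algebra.Bundles using (CommutativeSemiring)
open import Data.Fin as Fin using (Fin; toℕ; fromℕ; inject₁)
import Data.Fin.Properties as Fin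
open import Data.Integer as ℤ using (ℤ; +_; -[1+_]; _⊖_; _/ℕ_)
import Data.Integer.Properties as ℤ
import Data.Integer.Solver as ℤ-Solver
open import Data.List using (foldr; map; applyUpTo)
open import Data.Maybe using (Maybe; just; nothing)
open import Data.Nat as ℕ using (ℕ; zero; suc; _∸_; _≤_; _<_; _≥_; z≤n; s≤s; nonTrivial⇒n>1)
import Data.Nat.Properties as ℕ
import Data.Nat.Solver as ℕ-Solver
open import Data.Nat.Combinatorics using (_C_; nC1≡n; nCn≡1; nCk+nC[k+1]≡[n+1]C[k+1])
open import Data.Nat.Divisibility using (_∣_; divides; ∣-refl; ∣⇒≤)
open import Data.Nat.DivMod using (_/_; _%_; /-monoˡ-≤; m*n/n≡m; m*n%n≡0; +-distrib-/-∣ʳ)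
open import Data.Nat.Primality using (Prime; euclidsLemma; prime⇒irreducible; prime⇒nonTrivial)
open import Data.Product using (∃; ∃-syntax; _,_; proj₁; proj₂)
open import Data.Sum using (_⊎_; inj₁; inj₂)
open import Function using (_∘_)
open import Function.Bundles using (_⇔_; mk⇔; Inverse)
open import Relation.Binary.PropositionalEquality as ≡ using (_≡_; _≢_)
open import Relation.Nullary using (¬_; contradiction; yes; no)

[k+1]*[n+1]C[k+1]≡[n+1]*nCk : ∀ n k → suc k ℕ.* (suc n C suc k) ≡ suc n ℕ.* (n C k)
[k+1]*[n+1]C[k+1]≡[n+1]*nCk n zero = begin
  1 ℕ.* (suc n C 1) ≡⟨ ℕ.*-identityˡ _ ⟩
  suc n C 1         ≡⟨ nC1≡n (suc n) ⟩
  suc n             ≡⟨ ℕ.*-identityʳ (suc n) ⟨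
  suc n ℕ.* 1       ∎
  where open ≡.≡-Reasoning
[k+1]*[n+1]C[k+1]≡[n+1]*nCk zero (suc k) = ℕ.*-zeroʳ (2 ℕ.+ k)
[k+1]*[n+1]C[k+1]≡[n+1]*nCk (suc n) (suc k) = begin
  (2 ℕ.+ k) ℕ.* ((2 ℕ.+ n) C (2 ℕ.+ k))
    ≡⟨ ≡.cong ((2 ℕ.+ k) ℕ.*_) (nCk+nC[k+1]≡[n+1]C[k+1] (suc n) (suc k)) ⟨
  (2 ℕ.+ k) ℕ.* (X ℕ.+ Y)
    ≡⟨ solve 3 (λ k X Y → (con 2 :+ k) :* (X :+ Y) := (con 1 :+ k) :* X :+ (con 2 :+ k) :* Y :+ X) ≡.refl k X Y ⟩
  suc k ℕ.* X ℕ.+ (2 ℕ.+ k) ℕ.* Y ℕ.+ X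
    ≡⟨ ≡.cong₂ (λ u v → u ℕ.+ v ℕ.+ X) ([k+1]*[n+1]C[k+1]≡[n+1]*nCk n k) ([k+1]*[n+1]C[k+1]≡[n+1]*nCk n (suc k)) ⟩
  suc n ℕ.* (n C k) ℕ.+ suc n ℕ.* (n C suc k) ℕ.+ X
    ≡⟨ ≡.cong (ℕ._+ X) (ℕ.*-distribˡ-+ (suc n) (n C k) (n C suc k)) ⟨
  suc n ℕ.* (n C k ℕ.+ n C suc k) ℕ.+ X
    ≡⟨ ≡.cong (λ z → suc n ℕ.* z ℕ.+ X) (nCk+nC[k+1]≡[n+1]C[k+1] n k) ⟩
  suc n ℕ.* X ℕ.+ X
    ≡⟨ ℕ.+-comm (suc n ℕ.* X) X ⟩
  (2 ℕ.+ n) ℕ.* X ∎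
  where
  open ≡.≡-Reasoning
  open ℕ-Solver.+-*-Solver
  X = suc n C suc k
  Y = suc n C (2 ℕ.+ k)

[n+1∸k]C[k+1]≡[n∸k]Ck+[n∸k]C[k+1] : ∀ n k → (suc n ∸ k) C suc k ≡ (n ∸ k) C k ℕ.+ (n ∸ k) C suc k
[n+1∸k]C[k+1]≡[n∸k]Ck+[n∸k]C[k+1] n k with k ℕ.≤? n
... | yes k≤n rewrite ℕ.+-∸-assoc 1 k≤n = ≡.sym (nCk+nC[k+1]≡[n+1]C[k+1] (n ∸ k) k)
... | no k≰n with ℕ.≰⇒> k≰n
...   | n<k@(s≤s _) rewrite ℕ.m≤n⇒m∸n≡0 n<k | ℕ.m≤n⇒m∸n≡0 (ℕ.<⇒≤ n<k) = ≡.refl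

prime⇒p∣pCk : ∀ {p k} → Prime p → 0 < k → k < p → p ∣ p C k
prime⇒p∣pCk {suc n} {suc k} p-prime _ k<p
  with euclidsLemma (suc k) (suc n C suc k) p-prime
         (divides (n C k) (≡.trans ([k+1]*[n+1]C[k+1]≡[n+1]*nCk n k) (ℕ.*-comm (suc n) (n C k))))
... | inj₁ p∣k+1 = contradiction (∣⇒≤ p∣k+1) (ℕ.<⇒≱ k<p)
... | inj₂ p∣pCk = p∣pCk

[2+n]/2≡1+n/2 : ∀ n → (2 ℕ.+ n) / 2 ≡ suc (n / 2)
[2+n]/2≡1+n/2 n = ≡.trans (≡.cong (_/ 2) (ℕ.+-comm 2 n))
  (≡.trans (+-distrib-/-∣ʳ n ∣-refl) (ℕ.+-comm (n / 2) 1))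

[1+2j+1]/2≡1+j : ∀ j → (suc (j ℕ.+ j) ℕ.+ 1) / 2 ≡ suc j
[1+2j+1]/2≡1+j j = ≡.trans (≡.cong (_/ 2) (solve 1 (λ j → (con 1 :+ (j :+ j)) :+ con 1 := (con 1 :+ j) :* con 2) ≡.refl j))
  (m*n/n≡m (suc j) 2)
  where open ℕ-Solver.+-*-Solver

[1+2j∸1]/2≡j : ∀ j → (suc (j ℕ.+ j) ∸ 1) / 2 ≡ j
[1+2j∸1]/2≡j j = ≡.trans (≡.cong (_/ 2) (solve 1 (λ j → j :+ j := j :* con 2) ≡.refl j)) (m*n/n≡m j 2)
  where open ℕ-Solver.+-*-Solver

even⊎odd : ∀ n → ∃[ a ] (n ≡ a ℕ.+ a ⊎ n ≡ suc (a ℕ.+ a))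
even⊎odd zero = 0 , inj₁ ≡.refl
even⊎odd (suc n) with even⊎odd n
... | a , inj₁ n≡2a = a , inj₂ (≡.cong suc n≡2a)
... | a , inj₂ n≡2a+1 = suc a , inj₁ (≡.cong suc (≡.trans n≡2a+1 (≡.sym (ℕ.+-suc a a))))

prime≢2⇒odd : ∀ {p} → Prime p → p ≢ 2 → ∃[ a ] p ≡ suc (a ℕ.+ a)
prime≢2⇒odd {p} p-prime p≢2 with even⊎odd p
... | a , inj₂ p≡2a+1 = a , p≡2a+1
... | a , inj₁ p≡2a
  with prime⇒irreducible p-prime
         (divides a (≡.trans p≡2a (≡.trans (≡.cong (a ℕ.+_) (≡.sym (ℕ.+-identityʳ a))) (ℕ.*-comm 2 a))))
...   | inj₁ ()
...   | inj₂ 2≡p = contradiction (≡.sym 2≡p) p≢2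

odd^n≡odd : ∀ a n → ∃[ j ] suc (a ℕ.+ a) ℕ.^ n ≡ suc (j ℕ.+ j)
odd^n≡odd a zero = 0 , ≡.refl
odd^n≡odd a (suc n) with odd^n≡odd a n
... | j , eq = j ℕ.+ a ℕ.* suc (j ℕ.+ j) , ≡.trans (≡.cong (suc (a ℕ.+ a) ℕ.*_) eq)
      (solve 2 (λ a j → (con 1 :+ (a :+ a)) :* (con 1 :+ (j :+ j))
                        := con 1 :+ ((j :+ a :* (con 1 :+ (j :+ j))) :+ (j :+ a :* (con 1 :+ (j :+ j))))) ≡.refl a j)
  where open ℕ-Solver.+-*-Solver

[q*d]/ℕd≡q : ∀ q d → (q ℤ.* + suc d) /ℕ suc d ≡ q
[q*d]/ℕd≡q (+ a) d = ≡.trans (≡.cong (_/ℕ suc d) (≡.sym (ℤ.pos-* a (suc d)))) (≡.cong +_ (m*n/n≡m a (suc d)))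
[q*d]/ℕd≡q -[1+ a ] d =
  ≡.trans (≡.cong (_/ℕ suc d) (≡.trans (≡.sym (ℤ.neg-distribˡ-* (+ suc a) (+ suc d)))
                                        (≡.cong ℤ.-_ (≡.sym (ℤ.pos-* (suc a) (suc d))))))
          negative
  where
  -- _/ℕ_ on a negative numerator branches on the remainder, which is 0 here.
  negative : ℤ.- (+ (suc a ℕ.* suc d)) /ℕ suc d ≡ -[1+ a ]
  negative with suc (d ℕ.+ a ℕ.* suc d) % suc d | m*n%n≡0 (suc a) (suc d)
  ... | .0 | ≡.refl = ≡.cong (λ z → ℤ.- (+ z)) (m*n/n≡m (suc a) (suc d))

-- The Frobenius endomorphism

module Frobenius {a ℓ} (S : CommutativeSemiring a ℓ) where
  open CommutativeSemiring S hiding (zero)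
  open import Algebra.Properties.Semiring.Exp semiring using (_^_; ^-congˡ; ^-assocʳ)
  open import Algebra.Properties.Semiring.Mult semiring using (_×_; ×-congʳ; ×-assocˡ; ×-assoc-*)
  open import Algebra.Properties.Semiring.Sum semiring using (sum; sum-cong-≋; sum-replicate-zero; sum-init-last)
  open import Algebra.Properties.CommutativeSemiring.Binomial S using (theorem; binomialTerm)
  open import Relation.Binary.Reasoning.Setoid setoid

  1^n≈1 : ∀ n → 1# ^ n ≈ 1#
  1^n≈1 zero = refl
  1^n≈1 (suc n) = trans (*-congˡ (1^n≈1 n)) (*-identityˡ 1#)

  n×0≈0 : ∀ n → n × 0# ≈ 0#
  n×0≈0 zero = refl
  n×0≈0 (suc n) = trans (+-identityˡ _) (n×0≈0 n)

  binomial-ends : ∀ n x y → (∀ k → 0 < k → k < 2 ℕ.+ n → ∀ z → ((2 ℕ.+ n) C k) × z ≈ 0#) →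
                  (x + y) ^ (2 ℕ.+ n) ≈ x ^ (2 ℕ.+ n) + y ^ (2 ℕ.+ n)
  binomial-ends n x y middle≈0 = begin
    (x + y) ^ m
      ≈⟨ theorem m x y ⟩
    term Fin.zero + sum (term ∘ Fin.suc)
      ≈⟨ +-congˡ (sum-init-last (term ∘ Fin.suc)) ⟩
    term Fin.zero + (sum (λ i → term (Fin.suc (inject₁ i))) + term (fromℕ m))
      ≈⟨ +-congˡ (+-congʳ (trans (sum-cong-≋ inner≈0) (sum-replicate-zero (suc n)))) ⟩
    term Fin.zero + (0# + term (fromℕ m))
      ≈⟨ +-congˡ (+-identityˡ _) ⟩
    (m C 0) × (1# * y ^ m) + (m C toℕ (fromℕ m)) × (x ^ toℕ (fromℕ m) * y ^ (m ∸ toℕ (fromℕ m)))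
      ≡⟨ ≡.cong (λ k → (m C 0) × (1# * y ^ m) + (m C k) × (x ^ k * y ^ (m ∸ k))) (Fin.toℕ-fromℕ m) ⟩
    1 × (1# * y ^ m) + (m C m) × (x ^ m * y ^ (m ∸ m))
      ≡⟨ ≡.cong₂ (λ u v → 1 × (1# * y ^ m) + u × (x ^ m * y ^ v)) (nCn≡1 m) (ℕ.n∸n≡0 m) ⟩
    1 × (1# * y ^ m) + 1 × (x ^ m * 1#)
      ≈⟨ +-cong (trans (+-identityʳ _) (*-identityˡ _)) (trans (+-identityʳ _) (*-identityʳ _)) ⟩
    y ^ m + x ^ m
      ≈⟨ +-comm _ _ ⟩
    x ^ m + y ^ m ∎
    where
    m = 2 ℕ.+ n
    term = binomialTerm x y m
    inner≈0 : ∀ (i : Fin (suc n)) → term (Fin.suc (inject₁ i)) ≈ 0#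
    inner≈0 i = middle≈0 (suc (toℕ (inject₁ i))) (s≤s z≤n)
      (s≤s (s≤s (≡.subst (_≤ n) (≡.sym (Fin.toℕ-inject₁ i)) (ℕ.≤-pred (Fin.toℕ<n i))))) _

  module _ {p} (p-prime : Prime p) (char : p × 1# ≈ 0#) where

    p×x≈0 : ∀ x → p × x ≈ 0#
    p×x≈0 x = begin
      p × x        ≈⟨ ×-congʳ p (*-identityˡ x) ⟨
      p × (1# * x) ≈⟨ ×-assoc-* p 1# x ⟨
      (p × 1#) * x ≈⟨ *-congʳ char ⟩
      0# * x       ≈⟨ zeroˡ x ⟩
      0#           ∎

    pCk×x≈0 : ∀ k → 0 < k → k < p → ∀ x → (p C k) × x ≈ 0#
    pCk×x≈0 k 0<k k<p x with prime⇒p∣pCk p-prime 0<k k<p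
    ... | divides q pCk≡q*p = begin
      (p C k) × x  ≡⟨ ≡.cong (_× x) pCk≡q*p ⟩
      (q ℕ.* p) × x ≈⟨ ×-assocˡ x q p ⟨
      q × (p × x)  ≈⟨ ×-congʳ q (p×x≈0 x) ⟩
      q × 0#       ≈⟨ n×0≈0 q ⟩
      0#           ∎

  frobenius : ∀ {p} → Prime p → p × 1# ≈ 0# → ∀ x y → (x + y) ^ p ≈ x ^ p + y ^ p
  frobenius {p} p-prime char x y with nonTrivial⇒n>1 p {{prime⇒nonTrivial p-prime}}
  ... | s≤s (s≤s {n = n} _) = binomial-ends n x y (pCk×x≈0 p-prime char)

  frobenius-^ : ∀ {p} → Prime p → p × 1# ≈ 0# → ∀ l x y →
                (x + y) ^ (p ℕ.^ l) ≈ x ^ (p ℕ.^ l) + y ^ (p ℕ.^ l)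
  frobenius-^ _ _ zero x y = trans (*-identityʳ _) (+-cong (sym (*-identityʳ x)) (sym (*-identityʳ y)))
  frobenius-^ {p} p-prime char (suc l) x y = begin
    (x + y) ^ (p ℕ.* q)        ≡⟨ ≡.cong ((x + y) ^_) (ℕ.*-comm p q) ⟩
    (x + y) ^ (q ℕ.* p)        ≈⟨ ^-assocʳ (x + y) q p ⟨
    ((x + y) ^ q) ^ p          ≈⟨ ^-congˡ p (frobenius-^ p-prime char l x y) ⟩
    (x ^ q + y ^ q) ^ p        ≈⟨ frobenius p-prime char (x ^ q) (y ^ q) ⟩
    (x ^ q) ^ p + (y ^ q) ^ p  ≈⟨ +-cong (^-assocʳ x q p) (^-assocʳ y q p) ⟩
    x ^ (q ℕ.* p) + y ^ (q ℕ.* p) ≡⟨ ≡.cong (λ k → x ^ k + y ^ k) (ℕ.*-comm q p) ⟩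
    x ^ (p ℕ.* q) + y ^ (p ℕ.* q) ∎
    where q = p ℕ.^ l

  frobenius-^-1+ : ∀ {p} → Prime p → p × 1# ≈ 0# → ∀ l y → (1# + y) ^ (p ℕ.^ l) ≈ 1# + y ^ (p ℕ.^ l)
  frobenius-^-1+ {p} p-prime char l y = trans (frobenius-^ p-prime char l 1# y) (+-congʳ (1^n≈1 (p ℕ.^ l)))

-- The coefficients of D

-- By absorption, for n = a + j + 2 and i = j + 1 the numerator (n − k i) C(n − i, i)
-- of Dcoeff is a multiple of n − i = a + 1, so the division in Dcoeff is exact.
Dnumerator-factor : ∀ a j k →
  (+ (suc a ℕ.+ suc j) ℤ.- + (suc k ℕ.* suc j)) ℤ.* + (suc a C suc j) ≡
  (+ (suc a C suc j) ℤ.- + (k ℕ.* (a C j))) ℤ.* + suc a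
Dnumerator-factor a j k = begin
  (+ (suc a ℕ.+ suc j) ℤ.- + (suc k ℕ.* suc j)) ℤ.* + X
    ≡⟨ ≡.cong₂ (λ u v → (u ℤ.- v) ℤ.* + X) (ℤ.pos-+ (suc a) (suc j))
                 (≡.trans (ℤ.pos-* (suc k) (suc j)) (≡.cong (ℤ._* + suc j) (ℤ.pos-+ 1 k))) ⟩
  (+ suc a ℤ.+ + suc j ℤ.- (+ 1 ℤ.+ + k) ℤ.* + suc j) ℤ.* + X
    ≡⟨ solve 4 (λ a j k X → (a :+ j :- (con (+ 1) :+ k) :* j) :* X := a :* X :- k :* (j :* X)) ≡.refl (+ suc a) (+ suc j) (+ k) (+ X) ⟩
  + suc a ℤ.* + X ℤ.- + k ℤ.* (+ suc j ℤ.* + X)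
    ≡⟨ ≡.cong (λ z → + suc a ℤ.* + X ℤ.- + k ℤ.* z) absorption ⟩
  + suc a ℤ.* + X ℤ.- + k ℤ.* (+ suc a ℤ.* + Y)
    ≡⟨ solve 4 (λ a k X Y → a :* X :- k :* (a :* Y) := (X :- k :* Y) :* a) ≡.refl (+ suc a) (+ k) (+ X) (+ Y) ⟩
  (+ X ℤ.- + k ℤ.* + Y) ℤ.* + suc a
    ≡⟨ ≡.cong (λ z → (+ X ℤ.- z) ℤ.* + suc a) (ℤ.pos-* k Y) ⟨
  (+ X ℤ.- + (k ℕ.* Y)) ℤ.* + suc a ∎
  where
  open ≡.≡-Reasoning
  open ℤ-Solver.+-*-Solver
  X = suc a C suc j
  Y = a C j
  absorption : + suc j ℤ.* + X ≡ + suc a ℤ.* + Y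
  absorption = ≡.trans (≡.sym (ℤ.pos-* (suc j) X))
    (≡.trans (≡.cong +_ ([k+1]*[n+1]C[k+1]≡[n+1]*nCk a j)) (ℤ.pos-* (suc a) Y))

module _ {c ℓ} (F : Field c ℓ) where
  open ≡.≡-Reasoning

  Dcoeff-exact : ∀ n k i {m} q → n ∸ i ≡ suc m →
                 (+ n ℤ.- + (k ℕ.* i)) ℤ.* + (suc m C i) ≡ q ℤ.* + suc m → Dcoeff F n k i ≡ q
  Dcoeff-exact n k i {m} q n∸i≡1+m numerator≡ with n ∸ i in eq
  Dcoeff-exact n k i {m} q ≡.refl numerator≡ | suc m = begin
    ((+ n ℤ.- + (k ℕ.* i)) ℤ.* + ((n ∸ i) C i)) /ℕ suc m ≡⟨ ≡.cong (λ d → ((+ n ℤ.- + (k ℕ.* i)) ℤ.* + (d C i)) /ℕ suc m) eq ⟩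
    ((+ n ℤ.- + (k ℕ.* i)) ℤ.* + (suc m C i)) /ℕ suc m ≡⟨ ≡.cong (_/ℕ suc m) numerator≡ ⟩
    (q ℤ.* + suc m) /ℕ suc m                           ≡⟨ [q*d]/ℕd≡q q m ⟩
    q                                                  ∎

  Dcoeff-vanishes : ∀ n k i → n ∸ i ≡ 0 → Dcoeff F n k i ≡ + 0
  Dcoeff-vanishes n k i n∸i≡0 with n ∸ i
  Dcoeff-vanishes n k i ≡.refl | zero = ≡.refl

  Dcoeff-0 : ∀ r k → Dcoeff F (2 ℕ.+ r) k 0 ≡ + 1
  Dcoeff-0 r k = Dcoeff-exact (2 ℕ.+ r) k 0 (+ 1) ≡.refl numerator≡
    where
    open ℤ-Solver.+-*-Solver
    numerator≡ : (+ (2 ℕ.+ r) ℤ.- + (k ℕ.* 0)) ℤ.* + 1 ≡ + 1 ℤ.* + (2 ℕ.+ r)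
    numerator≡ rewrite ℕ.*-zeroʳ k = solve 1 (λ n → (n :- con (+ 0)) :* con (+ 1) := con (+ 1) :* n) ≡.refl (+ (2 ℕ.+ r))

  Dcoeff-suc : ∀ r k j → j ≤ r →
               Dcoeff F (2 ℕ.+ r) (suc k) (suc j) ≡ + (suc (r ∸ j) C suc j) ℤ.- + (k ℕ.* ((r ∸ j) C j))
  Dcoeff-suc r k j j≤r = Dcoeff-exact (2 ℕ.+ r) (suc k) (suc j) _ (ℕ.+-∸-assoc 1 j≤r)
    (≡.trans (≡.cong (λ n → (+ n ℤ.- + (suc k ℕ.* suc j)) ℤ.* + (suc (r ∸ j) C suc j)) 2+r≡)
             (Dnumerator-factor (r ∸ j) j k))
    where
    2+r≡ : 2 ℕ.+ r ≡ suc (r ∸ j) ℕ.+ suc j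
    2+r≡ = ≡.cong suc (≡.trans (≡.cong suc (≡.sym (ℕ.m∸n+n≡m j≤r))) (≡.sym (ℕ.+-suc (r ∸ j) j)))

  Dcoeff-suc-vanishes : ∀ r k j → r < j → Dcoeff F (2 ℕ.+ r) k (suc j) ≡ + 0
  Dcoeff-suc-vanishes r k j r<j = Dcoeff-vanishes (2 ℕ.+ r) k (suc j) (ℕ.m≤n⇒m∸n≡0 r<j)

module _ {c ℓ} (F : Field c ℓ) where
  open Field F hiding (zero)
  open import Algebra.Properties.Ring ring using (-‿+-comm; -‿involutive; -‿distribˡ-*; -‿distribʳ-*; -0#≈0#)
  open import Relation.Binary.Reasoning.Setoid setoid

  natF-+ : ∀ m n → natF F (m ℕ.+ n) ≈ natF F m + natF F n
  natF-+ zero n = sym (+-identityˡ _)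
  natF-+ (suc m) n = trans (+-congˡ (natF-+ m n)) (sym (+-assoc _ _ _))

  natF-* : ∀ m n → natF F (m ℕ.* n) ≈ natF F m * natF F n
  natF-* zero n = sym (zeroˡ _)
  natF-* (suc m) n = begin
    natF F (n ℕ.+ m ℕ.* n)            ≈⟨ natF-+ n (m ℕ.* n) ⟩
    natF F n + natF F (m ℕ.* n)       ≈⟨ +-congˡ (natF-* m n) ⟩
    natF F n + natF F m * natF F n    ≈⟨ +-congʳ (*-identityˡ _) ⟨
    1# * natF F n + natF F m * natF F n ≈⟨ distribʳ _ _ _ ⟨
    (1# + natF F m) * natF F n        ∎

  intF-⊖ : ∀ m n → intF F (m ⊖ n) ≈ natF F m - natF F n
  intF-⊖ zero zero = sym (-‿inverseʳ 0#)
  intF-⊖ zero (suc n) = sym (+-identityˡ _)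
  intF-⊖ (suc m) zero = sym (trans (+-congˡ -0#≈0#) (+-identityʳ _))
  intF-⊖ (suc m) (suc n) = begin
    intF F (suc m ⊖ suc n)          ≡⟨ ≡.cong (intF F) (ℤ.[1+m]⊖[1+n]≡m⊖n m n) ⟩
    intF F (m ⊖ n)                  ≈⟨ intF-⊖ m n ⟩
    natF F m - natF F n             ≈⟨ shift ⟩
    (1# + natF F m) - (1# + natF F n) ∎
    where
    shift : natF F m - natF F n ≈ (1# + natF F m) - (1# + natF F n)
    shift = begin
      natF F m - natF F n                   ≈⟨ +-identityˡ _ ⟨
      0# + (natF F m - natF F n)            ≈⟨ +-congʳ (-‿inverseʳ 1#) ⟨
      (1# - 1#) + (natF F m - natF F n)     ≈⟨ +-assoc _ _ _ ⟩
      1# + (- 1# + (natF F m - natF F n))   ≈⟨ +-congˡ (+-assoc _ _ _) ⟨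
      1# + ((- 1# + natF F m) - natF F n)   ≈⟨ +-congˡ (+-congʳ (+-comm _ _)) ⟩
      1# + ((natF F m - 1#) - natF F n)     ≈⟨ +-congˡ (+-assoc _ _ _) ⟩
      1# + (natF F m + (- 1# - natF F n))   ≈⟨ +-assoc _ _ _ ⟨
      (1# + natF F m) + (- 1# - natF F n)   ≈⟨ +-congˡ (-‿+-comm 1# (natF F n)) ⟩
      (1# + natF F m) - (1# + natF F n)     ∎

  intF-neg : ∀ i → intF F (ℤ.- i) ≈ - intF F i
  intF-neg (+ zero) = sym -0#≈0#
  intF-neg (+ suc n) = refl
  intF-neg -[1+ n ] = sym (-‿involutive _)

  intF-+ : ∀ i j → intF F (i ℤ.+ j) ≈ intF F i + intF F j
  intF-+ (+ m) (+ n) = natF-+ m n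
  intF-+ (+ m) -[1+ n ] = intF-⊖ m (suc n)
  intF-+ -[1+ m ] (+ n) = trans (intF-⊖ n (suc m)) (+-comm _ _)
  intF-+ -[1+ m ] -[1+ n ] = begin
    - natF F (2 ℕ.+ (m ℕ.+ n))            ≡⟨ ≡.cong (λ k → - natF F (suc k)) (ℕ.+-suc m n) ⟨
    - natF F (suc m ℕ.+ suc n)            ≈⟨ -‿cong (natF-+ (suc m) (suc n)) ⟩
    - (natF F (suc m) + natF F (suc n))   ≈⟨ -‿+-comm _ _ ⟨
    - natF F (suc m) + - natF F (suc n)   ∎

  intF-+* : ∀ m j → intF F (+ m ℤ.* j) ≈ natF F m * intF F j
  intF-+* m (+ n) = trans (reflexive (≡.cong (intF F) (≡.sym (ℤ.pos-* m n)))) (natF-* m n)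
  intF-+* m -[1+ n ] = begin
    intF F (+ m ℤ.* ℤ.- (+ suc n))    ≡⟨ ≡.cong (intF F) (ℤ.neg-distribʳ-* (+ m) (+ suc n)) ⟨
    intF F (ℤ.- (+ m ℤ.* + suc n))    ≈⟨ intF-neg (+ m ℤ.* + suc n) ⟩
    - intF F (+ m ℤ.* + suc n)        ≈⟨ -‿cong (intF-+* m (+ suc n)) ⟩
    - (natF F m * natF F (suc n))     ≈⟨ -‿distribʳ-* _ _ ⟩
    natF F m * - natF F (suc n)       ∎

  intF-* : ∀ i j → intF F (i ℤ.* j) ≈ intF F i * intF F j
  intF-* (+ m) j = intF-+* m j
  intF-* -[1+ m ] j = begin
    intF F (ℤ.- (+ suc m) ℤ.* j)      ≡⟨ ≡.cong (intF F) (ℤ.neg-distribˡ-* (+ suc m) j) ⟨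
    intF F (ℤ.- (+ suc m ℤ.* j))      ≈⟨ intF-neg (+ suc m ℤ.* j) ⟩
    - intF F (+ suc m ℤ.* j)          ≈⟨ -‿cong (intF-+* (suc m) j) ⟩
    - (natF F (suc m) * intF F j)     ≈⟨ -‿distribˡ-* _ _ ⟩
    - natF F (suc m) * intF F j       ∎

  -- Unlike intF, numeral (+ 2) is 1# + 1# on the nose, so the solver's constants
  -- coincide with numerals written in 1# alone.
  natNumeral : ℕ → Carrier
  natNumeral zero = 0#
  natNumeral (suc zero) = 1#
  natNumeral (suc (suc n)) = 1# + natNumeral (suc n)

  numeral : ℤ → Carrier
  numeral (+ n) = natNumeral n
  numeral -[1+ n ] = - natNumeral (suc n)

  natNumeral≈natF : ∀ n → natNumeral n ≈ natF F n
  natNumeral≈natF zero = refl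
  natNumeral≈natF (suc zero) = sym (+-identityʳ 1#)
  natNumeral≈natF (suc (suc n)) = +-congˡ (natNumeral≈natF (suc n))

  numeral≈intF : ∀ i → numeral i ≈ intF F i
  numeral≈intF (+ n) = natNumeral≈natF n
  numeral≈intF -[1+ n ] = -‿cong (natNumeral≈natF (suc n))

  open import Algebra.Solver.Ring.AlmostCommutativeRing using (AlmostCommutativeRing; fromCommutativeRing; _-Raw-AlmostCommutative⟶_)

  numeral-homomorphism : ℤ.+-*-rawRing -Raw-AlmostCommutative⟶ fromCommutativeRing commRing
  numeral-homomorphism = record
    { ⟦_⟧ = numeral
    ; +-homo = λ i j → homo (i ℤ.+ j) (intF-+ i j) (+-cong (numeral≈intF i) (numeral≈intF j))
    ; *-homo = λ i j → homo (i ℤ.* j) (intF-* i j) (*-cong (numeral≈intF i) (numeral≈intF j))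
    ; -‿homo = λ i → homo (ℤ.- i) (intF-neg i) (-‿cong (numeral≈intF i))
    ; 0-homo = refl
    ; 1-homo = refl
    }
    where
    homo : ∀ {y z} i → intF F i ≈ y → z ≈ y → numeral i ≈ z
    homo i i≈y z≈y = trans (numeral≈intF i) (trans i≈y (sym z≈y))

  numeral-≟ : ∀ i j → Maybe (numeral i ≈ numeral j)
  numeral-≟ i j with i ℤ.≟ j
  ... | yes ≡.refl = just refl
  ... | no _ = nothing

  open import Algebra.Solver.Ring ℤ.+-*-rawRing (fromCommutativeRing commRing) numeral-homomorphism numeral-≟

  pow-cong : ∀ n {x y} → x ≈ y → pow F x n ≈ pow F y n
  pow-cong zero _ = refl
  pow-cong (suc n) x≈y = *-cong x≈y (pow-cong n x≈y)

  sumUpTo : ℕ → (ℕ → Carrier) → Carrier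
  sumUpTo zero f = 0#
  sumUpTo (suc L) f = f 0 + sumUpTo L (f ∘ suc)

  sumUpTo-cong : ∀ L {f g} → (∀ i → f i ≈ g i) → sumUpTo L f ≈ sumUpTo L g
  sumUpTo-cong zero f≈g = refl
  sumUpTo-cong (suc L) f≈g = +-cong (f≈g 0) (sumUpTo-cong L (f≈g ∘ suc))

  sumUpTo-distrib-+ : ∀ L f g → sumUpTo L (λ i → f i + g i) ≈ sumUpTo L f + sumUpTo L g
  sumUpTo-distrib-+ zero f g = sym (+-identityˡ 0#)
  sumUpTo-distrib-+ (suc L) f g = trans (+-congˡ (sumUpTo-distrib-+ L (f ∘ suc) (g ∘ suc)))
    (solve 4 (λ a b c d → (a :+ b) :+ (c :+ d) := (a :+ c) :+ (b :+ d)) refl _ _ _ _)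

  *-distribˡ-sumUpTo : ∀ L a f → sumUpTo L (λ i → a * f i) ≈ a * sumUpTo L f
  *-distribˡ-sumUpTo zero a f = sym (zeroʳ a)
  *-distribˡ-sumUpTo (suc L) a f = trans (+-congˡ (*-distribˡ-sumUpTo L a (f ∘ suc))) (sym (distribˡ _ _ _))

  sumUpTo-zero : ∀ L f → (∀ i → f i ≈ 0#) → sumUpTo L f ≈ 0#
  sumUpTo-zero zero f f≈0 = refl
  sumUpTo-zero (suc L) f f≈0 = trans (+-cong (f≈0 0) (sumUpTo-zero L (f ∘ suc) (f≈0 ∘ suc))) (+-identityˡ 0#)

  foldr-map-applyUpTo : ∀ L (f : ℕ → Carrier) g → foldr _+_ 0# (map f (applyUpTo g L)) ≡ sumUpTo L (f ∘ g)
  foldr-map-applyUpTo zero f g = ≡.refl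
  foldr-map-applyUpTo (suc L) f g = ≡.cong (_+_ (f (g 0))) (foldr-map-applyUpTo L f (g ∘ suc))

  D≡sumUpTo : ∀ n k x → D F n k x ≡ sumUpTo (suc (n / 2)) (λ i → intF F (Dcoeff F n k i) * pow F (- x) i)
  D≡sumUpTo n k x = foldr-map-applyUpTo (suc (n / 2)) _ (λ i → i)

  Trinomial-cong : ∀ p l k {x y} → x ≈ y → Trinomial F p l k x ≈ Trinomial F p l k y
  Trinomial-cong p l k x≈y =
    +-cong (+-cong (*-congˡ (pow-cong ((p ℕ.^ l ℕ.+ 1) / 2) x≈y)) (*-congˡ (pow-cong ((p ℕ.^ l ∸ 1) / 2) x≈y)))
           (*-congˡ x≈y)

  intF-Dcoeff-0 : ∀ r k → intF F (Dcoeff F (2 ℕ.+ r) k 0) ≈ 1#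
  intF-Dcoeff-0 r k = trans (reflexive (≡.cong (intF F) (Dcoeff-0 F r k))) (+-identityʳ 1#)

  intF-Dcoeff-suc : ∀ r k j → intF F (Dcoeff F (2 ℕ.+ r) (suc k) (suc j)) ≈
                    natF F ((suc r ∸ j) C suc j) - natF F k * natF F ((r ∸ j) C j)
  intF-Dcoeff-suc r k j with j ℕ.≤? r
  ... | yes j≤r = begin
    intF F (Dcoeff F (2 ℕ.+ r) (suc k) (suc j))
      ≡⟨ ≡.cong (intF F) (Dcoeff-suc F r k j j≤r) ⟩
    intF F (+ (suc (r ∸ j) C suc j) ℤ.+ ℤ.- + (k ℕ.* ((r ∸ j) C j)))
      ≈⟨ intF-+ (+ (suc (r ∸ j) C suc j)) (ℤ.- + (k ℕ.* ((r ∸ j) C j))) ⟩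
    natF F (suc (r ∸ j) C suc j) + intF F (ℤ.- + (k ℕ.* ((r ∸ j) C j)))
      ≈⟨ +-congˡ (trans (intF-neg (+ (k ℕ.* ((r ∸ j) C j)))) (-‿cong (natF-* k ((r ∸ j) C j)))) ⟩
    natF F (suc (r ∸ j) C suc j) - natF F k * natF F ((r ∸ j) C j)
      ≡⟨ ≡.cong (λ m → natF F (m C suc j) - natF F k * natF F ((r ∸ j) C j)) (ℕ.+-∸-assoc 1 j≤r) ⟨
    natF F ((suc r ∸ j) C suc j) - natF F k * natF F ((r ∸ j) C j) ∎
  ... | no j≰r with ℕ.≰⇒> j≰r
  ...   | r<j@(s≤s _) = begin
    intF F (Dcoeff F (2 ℕ.+ r) (suc k) (suc j))
      ≡⟨ ≡.cong (intF F) (Dcoeff-suc-vanishes F r (suc k) j r<j) ⟩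
    0#
      ≈⟨ solve 1 (λ k → con (+ 0) := con (+ 0) :- k :* con (+ 0)) refl (natF F k) ⟩
    0# - natF F k * 0#
      ≡⟨ ≡.cong₂ (λ m m′ → natF F (m C suc j) - natF F k * natF F (m′ C j)) (ℕ.m≤n⇒m∸n≡0 r<j) (ℕ.m≤n⇒m∸n≡0 (ℕ.<⇒≤ r<j)) ⟨
    natF F ((suc r ∸ j) C suc j) - natF F k * natF F ((r ∸ j) C j) ∎

  -- D as a Fibonacci-type sequence

  module Fibonacci (x : Carrier) where

    fib : ℕ → Carrier
    fib zero = 0#
    fib (suc zero) = 1#
    fib (suc (suc n)) = fib (suc n) - x * fib n

    term : ℕ → ℕ → Carrier
    term n i = natF F ((n ∸ i) C i) * pow F (- x) i

    term-pascal : ∀ n i → term (2 ℕ.+ n) (suc i) ≈ - x * term n i + term (suc n) (suc i)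
    term-pascal n i = begin
      natF F ((suc n ∸ i) C suc i) * (- x * pow F (- x) i)
        ≡⟨ ≡.cong (λ c → natF F c * (- x * pow F (- x) i)) ([n+1∸k]C[k+1]≡[n∸k]Ck+[n∸k]C[k+1] n i) ⟩
      natF F ((n ∸ i) C i ℕ.+ (n ∸ i) C suc i) * (- x * pow F (- x) i)
        ≈⟨ *-congʳ (natF-+ ((n ∸ i) C i) ((n ∸ i) C suc i)) ⟩
      (natF F ((n ∸ i) C i) + natF F ((n ∸ i) C suc i)) * (- x * pow F (- x) i)
        ≈⟨ solve 4 (λ a b y q → (a :+ b) :* (y :* q) := y :* (a :* q) :+ b :* (y :* q)) refl _ _ _ _ ⟩
      - x * term n i + term (suc n) (suc i) ∎

    term-1-suc : ∀ i → term 1 (suc i) ≈ 0#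
    term-1-suc i rewrite ℕ.0∸n≡0 i = zeroˡ _

    sumUpTo-term : ∀ n L → suc (n / 2) ≤ L → sumUpTo L (term n) ≈ fib (suc n)
    sumUpTo-term zero (suc L) _ = begin
      term 0 0 + sumUpTo L (term 0 ∘ suc)  ≈⟨ +-cong (*-identityʳ _) (sumUpTo-zero L _ (λ _ → zeroˡ _)) ⟩
      (1# + 0#) + 0#                       ≈⟨ trans (+-identityʳ _) (+-identityʳ _) ⟩
      1#                                   ∎
    sumUpTo-term (suc zero) (suc L) _ = begin
      term 1 0 + sumUpTo L (term 1 ∘ suc)  ≈⟨ +-cong (*-identityʳ _) (sumUpTo-zero L _ term-1-suc) ⟩
      (1# + 0#) + 0#                       ≈⟨ solve 1 (λ x → (con (+ 1) :+ con (+ 0)) :+ con (+ 0) := con (+ 1) :- x :* con (+ 0)) refl x ⟩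
      1# - x * 0#                          ∎
    sumUpTo-term (suc (suc n)) (suc L) bound = begin
      term (2 ℕ.+ n) 0 + sumUpTo L (term (2 ℕ.+ n) ∘ suc)
        ≈⟨ +-congˡ (sumUpTo-cong L (term-pascal n)) ⟩
      term (suc n) 0 + sumUpTo L (λ i → - x * term n i + term (suc n) (suc i))
        ≈⟨ +-congˡ (sumUpTo-distrib-+ L _ _) ⟩
      term (suc n) 0 + (sumUpTo L (λ i → - x * term n i) + sumUpTo L (term (suc n) ∘ suc))
        ≈⟨ +-congˡ (+-congʳ (*-distribˡ-sumUpTo L (- x) (term n))) ⟩
      term (suc n) 0 + (- x * sumUpTo L (term n) + sumUpTo L (term (suc n) ∘ suc))
        ≈⟨ solve 3 (λ a b c → a :+ (b :+ c) := (a :+ c) :+ b) refl _ _ _ ⟩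
      sumUpTo (suc L) (term (suc n)) + - x * sumUpTo L (term n)
        ≈⟨ +-cong (sumUpTo-term (suc n) (suc L) [1+n]/2<1+L) (*-congˡ (sumUpTo-term n L n/2<L)) ⟩
      fib (2 ℕ.+ n) + - x * fib (suc n)
        ≈⟨ solve 3 (λ a b x → a :+ (:- x) :* b := a :- x :* b) refl _ _ x ⟩
      fib (3 ℕ.+ n) ∎
      where
      n/2<L : suc (n / 2) ≤ L
      n/2<L = ℕ.≤-pred (≡.subst (λ m → suc m ≤ suc L) ([2+n]/2≡1+n/2 n) bound)
      [1+n]/2<1+L : suc (suc n / 2) ≤ suc L
      [1+n]/2<1+L = ℕ.≤-trans (s≤s (/-monoˡ-≤ 2 (ℕ.n≤1+n (suc n)))) bound

    D≈fib : ∀ r k → D F (2 ℕ.+ r) (suc k) x ≈ fib (3 ℕ.+ r) + (natF F k * x) * fib (suc r)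
    D≈fib r k = begin
      D F n (suc k) x
        ≡⟨ D≡sumUpTo n (suc k) x ⟩
      sumUpTo (suc (n / 2)) Dterm
        ≡⟨ ≡.cong (λ L → sumUpTo (suc L) Dterm) ([2+n]/2≡1+n/2 r) ⟩
      Dterm 0 + sumUpTo L (Dterm ∘ suc)
        ≈⟨ +-cong Dterm-0 (sumUpTo-cong L Dterm-suc) ⟩
      term n 0 + sumUpTo L (λ j → term n (suc j) + (natF F k * x) * term r j)
        ≈⟨ +-congˡ (trans (sumUpTo-distrib-+ L (term n ∘ suc) (λ j → (natF F k * x) * term r j))
                          (+-congˡ (*-distribˡ-sumUpTo L (natF F k * x) (term r)))) ⟩
      term n 0 + (sumUpTo L (term n ∘ suc) + (natF F k * x) * sumUpTo L (term r))
        ≈⟨ +-assoc _ _ _ ⟨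
      sumUpTo (suc L) (term n) + (natF F k * x) * sumUpTo L (term r)
        ≈⟨ +-cong (sumUpTo-term n (suc L) (≡.subst (λ m → suc m ≤ suc L) (≡.sym ([2+n]/2≡1+n/2 r)) ℕ.≤-refl))
                  (*-congˡ (sumUpTo-term r L ℕ.≤-refl)) ⟩
      fib (suc n) + (natF F k * x) * fib (suc r) ∎
      where
      n = 2 ℕ.+ r
      L = suc (r / 2)
      Dterm : ℕ → Carrier
      Dterm i = intF F (Dcoeff F n (suc k) i) * pow F (- x) i
      Dterm-0 : Dterm 0 ≈ term n 0
      Dterm-0 = *-congʳ (trans (intF-Dcoeff-0 r (suc k)) (sym (+-identityʳ 1#)))
      Dterm-suc : ∀ j → Dterm (suc j) ≈ term n (suc j) + (natF F k * x) * term r j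
      Dterm-suc j = trans (*-congʳ (intF-Dcoeff-suc r k j))
        (solve 5 (λ a k b x q → (a :- k :* b) :* (:- x :* q) := a :* (:- x :* q) :+ (k :* x) :* (b :* q)) refl _ _ _ x _)

  -- (a , b) represents a + b √t; t need not be a square in F.
  module Adjoin√ (t : Carrier) where
    open import Data.Product using (_×_)
    open import Algebra.Structures using (IsCommutativeMonoid)
    open import Algebra.Structures.Biased using (IsCommutativeSemiringˡ)
    open import Relation.Binary.Structures using (IsEquivalence)

    K : Set c
    K = Carrier × Carrier

    infix 4 _≈K_
    _≈K_ : K → K → Set ℓ
    (a , b) ≈K (a′ , b′) = (a ≈ a′) × (b ≈ b′)

    _+K_ _*K_ : K → K → K
    (a , b) +K (a′ , b′) = (a + a′ , b + b′)
    (a , b) *K (a′ , b′) = (a * a′ + t * (b * b′) , a * b′ + b * a′)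

    0K 1K √t : K
    0K = (0# , 0#)
    1K = (1# , 0#)
    √t = (0# , 1#)

    ≈K-isEquivalence : IsEquivalence _≈K_
    ≈K-isEquivalence = record
      { refl = refl , refl
      ; sym = λ (a , b) → sym a , sym b
      ; trans = λ (a , b) (a′ , b′) → trans a a′ , trans b b′
      }

    +K-isCommutativeMonoid : IsCommutativeMonoid _≈K_ _+K_ 0K
    +K-isCommutativeMonoid = record
      { isMonoid = record
        { isSemigroup = record
          { isMagma = record
            { isEquivalence = ≈K-isEquivalence
            ; ∙-cong = λ (a , b) (a′ , b′) → +-cong a a′ , +-cong b b′
            }
          ; assoc = λ _ _ _ → +-assoc _ _ _ , +-assoc _ _ _
          }
        ; identity = (λ _ → +-identityˡ _ , +-identityˡ _) , (λ _ → +-identityʳ _ , +-identityʳ _)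
        }
      ; comm = λ _ _ → +-comm _ _ , +-comm _ _
      }

    *K-isCommutativeMonoid : IsCommutativeMonoid _≈K_ _*K_ 1K
    *K-isCommutativeMonoid = record
      { isMonoid = record
        { isSemigroup = record
          { isMagma = record
            { isEquivalence = ≈K-isEquivalence
            ; ∙-cong = λ (a , b) (a′ , b′) → +-cong (*-cong a a′) (*-congˡ (*-cong b b′)) , +-cong (*-cong a b′) (*-cong b a′)
            }
          ; assoc = λ (a , b) (c , d) (e , f) →
              solve 7 (λ a b c d e f t → (a :* c :+ t :* (b :* d)) :* e :+ t :* ((a :* d :+ b :* c) :* f)
                                    := a :* (c :* e :+ t :* (d :* f)) :+ t :* (b :* (c :* f :+ d :* e))) refl a b c d e f t
            , solve 7 (λ a b c d e f t → (a :* c :+ t :* (b :* d)) :* f :+ (a :* d :+ b :* c) :* e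
                                    := a :* (c :* f :+ d :* e) :+ b :* (c :* e :+ t :* (d :* f))) refl a b c d e f t
          }
        ; identity = (λ (a , b) → solve 3 (λ a b t → con (+ 1) :* a :+ t :* (con (+ 0) :* b) := a) refl a b t
                                , solve 2 (λ a b → con (+ 1) :* b :+ con (+ 0) :* a := b) refl a b)
                   , (λ (a , b) → solve 3 (λ a b t → a :* con (+ 1) :+ t :* (b :* con (+ 0)) := a) refl a b t
                                , solve 2 (λ a b → a :* con (+ 0) :+ b :* con (+ 1) := b) refl a b)
        }
      ; comm = λ (a , b) (c , d) → solve 5 (λ a b c d t → a :* c :+ t :* (b :* d) := c :* a :+ t :* (d :* b)) refl a b c d t
                                 , solve 4 (λ a b c d → a :* d :+ b :* c := c :* b :+ d :* a) refl a b c d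
      }

    K-commutativeSemiring : CommutativeSemiring c ℓ
    K-commutativeSemiring = record
      { Carrier = K
      ; _≈_ = _≈K_
      ; _+_ = _+K_
      ; _*_ = _*K_
      ; 0# = 0K
      ; 1# = 1K
      ; isCommutativeSemiring = IsCommutativeSemiringˡ.isCommutativeSemiring {_≈_ = _≈K_} (record
        { +-isCommutativeMonoid = +K-isCommutativeMonoid
        ; *-isCommutativeMonoid = *K-isCommutativeMonoid
        ; distribʳ = λ (a , b) (c , d) (e , f) →
            solve 7 (λ a b c d e f t → (c :+ e) :* a :+ t :* ((d :+ f) :* b) := (c :* a :+ t :* (d :* b)) :+ (e :* a :+ t :* (f :* b))) refl a b c d e f t
          , solve 6 (λ a b c d e f → (c :+ e) :* b :+ (d :+ f) :* a := (c :* b :+ d :* a) :+ (e :* b :+ f :* a)) refl a b c d e f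
        ; zeroˡ = λ (a , b) → solve 3 (λ a b t → con (+ 0) :* a :+ t :* (con (+ 0) :* b) := con (+ 0)) refl a b t
                            , solve 2 (λ a b → con (+ 0) :* b :+ con (+ 0) :* a := con (+ 0)) refl a b
        })
      }

  two three four eight : Carrier
  two = 1# + 1#
  three = 1# + two
  four = 1# + three
  eight = two * (two * two)

  module Lucas (x : Carrier) where
    open Fibonacci x using (fib)

    t : Carrier
    t = 1# - four * x

    open Adjoin√ t
    open import Algebra.Properties.Semiring.Exp (CommutativeSemiring.semiring K-commutativeSemiring)
      using () renaming (_^_ to _^K_)

    A B : ℕ → Carrier
    A n = proj₁ ((1K +K √t) ^K n)
    B n = proj₂ ((1K +K √t) ^K n)

    A-suc : ∀ n → A (suc n) ≈ A n + t * B n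
    A-suc n = solve 3 (λ a b t → (con (+ 1) :+ con (+ 0)) :* a :+ t :* ((con (+ 0) :+ con (+ 1)) :* b) := a :+ t :* b) refl (A n) (B n) t

    B-suc : ∀ n → B (suc n) ≈ B n + A n
    B-suc n = solve 2 (λ a b → (con (+ 1) :+ con (+ 0)) :* b :+ (con (+ 0) :+ con (+ 1)) :* a := b :+ a) refl (A n) (B n)

    B-rec : ∀ n → B (2 ℕ.+ n) ≈ two * B (suc n) - four * x * B n
    B-rec n = begin
      B (2 ℕ.+ n)                      ≈⟨ B-suc (suc n) ⟩
      B (suc n) + A (suc n)            ≈⟨ +-cong (B-suc n) (A-suc n) ⟩
      (B n + A n) + (A n + t * B n)    ≈⟨ solve 3 (λ a b x → (b :+ a) :+ (a :+ (con (+ 1) :- con (+ 4) :* x) :* b)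
                                                         := con (+ 2) :* (b :+ a) :- con (+ 4) :* x :* b) refl (A n) (B n) x ⟩
      two * (B n + A n) - four * x * B n ≈⟨ +-congʳ (*-congˡ (B-suc n)) ⟨
      two * B (suc n) - four * x * B n ∎

    B≈2^n*fib : ∀ n → B (suc n) ≈ pow F two n * fib (suc n)
    B≈2^n*fib zero = solve 0 ((con (+ 1) :+ con (+ 0)) :* con (+ 0) :+ (con (+ 0) :+ con (+ 1)) :* con (+ 1) := con (+ 1) :* con (+ 1)) refl
    B≈2^n*fib (suc zero) = begin
      B 2                              ≈⟨ B-rec 0 ⟩
      two * B 1 - four * x * B 0       ≈⟨ +-congʳ (*-congˡ (B≈2^n*fib zero)) ⟩
      two * (1# * 1#) - four * x * B 0 ≈⟨ solve 1 (λ x → con (+ 2) :* (con (+ 1) :* con (+ 1)) :- con (+ 4) :* x :* con (+ 0)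
                                                        := con (+ 2) :* con (+ 1) :* (con (+ 1) :- x :* con (+ 0))) refl x ⟩
      (two * 1#) * (1# - x * 0#)       ∎
    B≈2^n*fib (suc (suc n)) = begin
      B (3 ℕ.+ n)
        ≈⟨ B-rec (suc n) ⟩
      two * B (2 ℕ.+ n) - four * x * B (suc n)
        ≈⟨ +-cong (*-congˡ (B≈2^n*fib (suc n))) (-‿cong (*-congˡ (B≈2^n*fib n))) ⟩
      two * (pow F two (suc n) * fib (2 ℕ.+ n)) - four * x * (pow F two n * fib (suc n))
        ≈⟨ solve 4 (λ q f₂ f₁ x → con (+ 2) :* ((con (+ 2) :* q) :* f₂) :- con (+ 4) :* x :* (q :* f₁)
                                := con (+ 2) :* (con (+ 2) :* q) :* (f₂ :- x :* f₁)) refl (pow F two n) (fib (2 ℕ.+ n)) (fib (suc n)) x ⟩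
      pow F two (2 ℕ.+ n) * fib (3 ℕ.+ n) ∎

    B[3+n]≈ : ∀ n → B (3 ℕ.+ n) ≈ (1# + three * t) * B n + (three + t) * A n
    B[3+n]≈ n = begin
      B (3 ℕ.+ n)
        ≈⟨ B-suc (2 ℕ.+ n) ⟩
      B (2 ℕ.+ n) + A (2 ℕ.+ n)
        ≈⟨ +-cong (B-suc (suc n)) (A-suc (suc n)) ⟩
      (B (suc n) + A (suc n)) + (A (suc n) + t * B (suc n))
        ≈⟨ +-cong (+-cong (B-suc n) (A-suc n)) (+-cong (A-suc n) (*-congˡ (B-suc n))) ⟩
      ((B n + A n) + (A n + t * B n)) + ((A n + t * B n) + t * (B n + A n))
        ≈⟨ solve 3 (λ a b t → ((b :+ a) :+ (a :+ t :* b)) :+ ((a :+ t :* b) :+ t :* (b :+ a))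
                              := (con (+ 1) :+ con (+ 3) :* t) :* b :+ (con (+ 3) :+ t) :* a) refl (A n) (B n) t ⟩
      (1# + three * t) * B n + (three + t) * A n ∎

    module _ {p} (p-prime : Prime p) (char : HasChar F p) (l j : ℕ) (p^l≡1+2j : p ℕ.^ l ≡ suc (j ℕ.+ j)) where
      open import Algebra.Properties.Semiring.Mult (CommutativeSemiring.semiring K-commutativeSemiring)
        using () renaming (_×_ to _×K_)
      open import Algebra.Properties.Semiring.Mult semiring using (_×_)
      open import Algebra.Properties.Semiring.Exp semiring using (_^_)
      module FrobeniusK = Frobenius K-commutativeSemiring
      module K = CommutativeSemiring K-commutativeSemiring
      module FrobeniusF = Frobenius commutativeSemiring

      m : ℕ
      m = p ℕ.^ l

      n×1≈natF : ∀ n → n × 1# ≈ natF F n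
      n×1≈natF zero = refl
      n×1≈natF (suc n) = +-congˡ (n×1≈natF n)

      n×1K≈natF : ∀ n → n ×K 1K ≈K (natF F n , 0#)
      n×1K≈natF zero = refl , refl
      n×1K≈natF (suc n) = +-congˡ (proj₁ (n×1K≈natF n)) , trans (+-congˡ (proj₂ (n×1K≈natF n))) (+-identityˡ 0#)

      pow≡^ : ∀ y n → pow F y n ≡ y ^ n
      pow≡^ y zero = ≡.refl
      pow≡^ y (suc n) = ≡.cong (y *_) (pow≡^ y n)

      √t^[1+2i] : ∀ i → √t ^K suc (i ℕ.+ i) ≈K (0# , pow F t i)
      √t^[1+2i] zero = K.*-identityʳ √t
      √t^[1+2i] (suc i) rewrite ℕ.+-suc i i = K.trans (K.*-congˡ (K.*-congˡ (√t^[1+2i] i)))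
        ( solve 2 (λ t q → con (+ 0) :* (con (+ 0) :* con (+ 0) :+ t :* (con (+ 1) :* q))
                           :+ t :* (con (+ 1) :* (con (+ 0) :* q :+ con (+ 1) :* con (+ 0))) := con (+ 0)) refl t (pow F t i)
        , solve 2 (λ t q → con (+ 0) :* (con (+ 0) :* q :+ con (+ 1) :* con (+ 0))
                           :+ con (+ 1) :* (con (+ 0) :* con (+ 0) :+ t :* (con (+ 1) :* q)) := t :* q) refl t (pow F t i) )

      [1+√t]^m : (1K +K √t) ^K m ≈K (1# + 0# , 0# + pow F t j)
      [1+√t]^m = K.trans (FrobeniusK.frobenius-^-1+ p-prime charK l √t)
                         (K.+-congˡ (≡.subst (λ e → √t ^K e ≈K (0# , pow F t j)) (≡.sym p^l≡1+2j) (√t^[1+2i] j)))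
        where
        charK : p ×K 1K ≈K 0K
        charK = trans (proj₁ (n×1K≈natF p)) char , proj₂ (n×1K≈natF p)

      2^m≈2 : pow F two m ≈ two
      2^m≈2 = begin
        pow F two m  ≡⟨ pow≡^ two m ⟩
        two ^ m      ≈⟨ FrobeniusF.frobenius-^-1+ p-prime (trans (n×1≈natF p) char) l 1# ⟩
        1# + 1# ^ m  ≈⟨ +-congˡ (FrobeniusF.1^n≈1 m) ⟩
        two          ∎

      two*fib[1+m]≈1+t^j : two * fib (suc m) ≈ 1# + pow F t j
      two*fib[1+m]≈1+t^j = begin
        two * fib (suc m)          ≈⟨ *-congʳ 2^m≈2 ⟨
        pow F two m * fib (suc m)  ≈⟨ B≈2^n*fib m ⟨
        B (suc m)                  ≈⟨ B-suc m ⟩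
        B m + A m                  ≈⟨ +-cong (proj₂ [1+√t]^m) (proj₁ [1+√t]^m) ⟩
        (0# + pow F t j) + (1# + 0#) ≈⟨ solve 1 (λ r → (con (+ 0) :+ r) :+ (con (+ 1) :+ con (+ 0)) := con (+ 1) :+ r) refl (pow F t j) ⟩
        1# + pow F t j             ∎

      eight*fib[3+m]≈[1+3t]t^j+3+t : eight * fib (3 ℕ.+ m) ≈ (1# + three * t) * pow F t j + (three + t)
      eight*fib[3+m]≈[1+3t]t^j+3+t = begin
        eight * fib (3 ℕ.+ m)                          ≈⟨ *-congʳ (*-congˡ (*-congˡ 2^m≈2)) ⟨
        two * (two * pow F two m) * fib (3 ℕ.+ m)      ≈⟨ B≈2^n*fib (2 ℕ.+ m) ⟨
        B (3 ℕ.+ m)                                    ≈⟨ B[3+n]≈ m ⟩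
        (1# + three * t) * B m + (three + t) * A m     ≈⟨ +-cong (*-congˡ (proj₂ [1+√t]^m)) (*-congˡ (proj₁ [1+√t]^m)) ⟩
        (1# + three * t) * (0# + pow F t j) + (three + t) * (1# + 0#)
          ≈⟨ solve 3 (λ a b r → a :* (con (+ 0) :+ r) :+ b :* (con (+ 1) :+ con (+ 0)) := a :* r :+ b) refl (1# + three * t) (three + t) (pow F t j) ⟩
        (1# + three * t) * pow F t j + (three + t)     ∎

      Trinomial[t]≈ : ∀ k → Trinomial F p l (suc k) t ≈
        (four - (1# + natF F k)) * (t * pow F t j) + (1# + natF F k) * pow F t j + (two - (1# + natF F k)) * t
      Trinomial[t]≈ k = begin
        intF F (+ 4 ℤ.- + suc k) * pow F t ((m ℕ.+ 1) / 2) + intF F (+ suc k) * pow F t ((m ∸ 1) / 2) + intF F (+ 2 ℤ.- + suc k) * t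
          ≡⟨ ≡.cong₂ (λ e e′ → intF F (+ 4 ℤ.- + suc k) * pow F t e + intF F (+ suc k) * pow F t e′ + intF F (+ 2 ℤ.- + suc k) * t)
                     (≡.trans (≡.cong (λ n → (n ℕ.+ 1) / 2) p^l≡1+2j) ([1+2j+1]/2≡1+j j))
                     (≡.trans (≡.cong (λ n → (n ∸ 1) / 2) p^l≡1+2j) ([1+2j∸1]/2≡j j)) ⟩
        intF F (4 ⊖ suc k) * (t * pow F t j) + (1# + natF F k) * pow F t j + intF F (2 ⊖ suc k) * t
          ≈⟨ +-cong (+-congʳ (*-congʳ (trans (intF-⊖ 4 (suc k)) (+-congʳ (sym (natNumeral≈natF 4))))))
                    (*-congʳ (trans (intF-⊖ 2 (suc k)) (+-congʳ (sym (natNumeral≈natF 2))))) ⟩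
        (four - (1# + natF F k)) * (t * pow F t j) + (1# + natF F k) * pow F t j + (two - (1# + natF F k)) * t ∎

      eight*D≈Trinomial : ∀ k → eight * D F (2 ℕ.+ m) (suc k) x ≈ Trinomial F p l (suc k) t + (two + (1# + natF F k))
      eight*D≈Trinomial k = begin
        eight * D F (2 ℕ.+ m) (suc k) x
          ≈⟨ *-congˡ (Fibonacci.D≈fib x m k) ⟩
        eight * (fib (3 ℕ.+ m) + (natF F k * x) * fib (suc m))
          ≈⟨ solve 4 (λ f₃ f₁ k x → con (+ 2) :* (con (+ 2) :* con (+ 2)) :* (f₃ :+ (k :* x) :* f₁)
                                 := con (+ 2) :* (con (+ 2) :* con (+ 2)) :* f₃ :+ (con (+ 4) :* (k :* x)) :* (con (+ 2) :* f₁))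
                     refl (fib (3 ℕ.+ m)) (fib (suc m)) (natF F k) x ⟩
        eight * fib (3 ℕ.+ m) + (four * (natF F k * x)) * (two * fib (suc m))
          ≈⟨ +-cong eight*fib[3+m]≈[1+3t]t^j+3+t (*-congˡ two*fib[1+m]≈1+t^j) ⟩
        ((1# + three * t) * pow F t j + (three + t)) + (four * (natF F k * x)) * (1# + pow F t j)
          ≈⟨ solve 3 (λ r k x → ((con (+ 1) :+ con (+ 3) :* (con (+ 1) :- con (+ 4) :* x)) :* r :+ (con (+ 3) :+ (con (+ 1) :- con (+ 4) :* x)))
                                 :+ (con (+ 4) :* (k :* x)) :* (con (+ 1) :+ r)
                               := (con (+ 4) :- (con (+ 1) :+ k)) :* ((con (+ 1) :- con (+ 4) :* x) :* r) :+ (con (+ 1) :+ k) :* r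
                                  :+ (con (+ 2) :- (con (+ 1) :+ k)) :* (con (+ 1) :- con (+ 4) :* x)
                                  :+ (con (+ 2) :+ (con (+ 1) :+ k))) refl (pow F t j) (natF F k) x ⟩
        (four - (1# + natF F k)) * (t * pow F t j) + (1# + natF F k) * pow F t j + (two - (1# + natF F k)) * t
          + (two + (1# + natF F k))
          ≈⟨ +-congʳ (Trinomial[t]≈ k) ⟨
        Trinomial F p l (suc k) t + (two + (1# + natF F k)) ∎

  -- Permutations up to affine change of variables

  IsPermutation-conjugate : (φ ψ : Inverse setoid setoid) {f g : Carrier → Carrier} →
    (∀ {x y} → x ≈ y → g x ≈ g y) → (∀ x → Inverse.to ψ (f x) ≈ g (Inverse.to φ x)) →
    IsPermutation F f ⇔ IsPermutation F g
  IsPermutation-conjugate φ ψ {f} {g} g-cong ψf≈gφ = mk⇔ to from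
    where
    module φ = Inverse φ
    module ψ = Inverse ψ
    φ-injective : ∀ {x y} → φ.to x ≈ φ.to y → x ≈ y
    φ-injective {x} {y} φx≈φy = trans (sym (φ.strictlyInverseʳ x)) (trans (φ.from-cong φx≈φy) (φ.strictlyInverseʳ y))
    ψ-injective : ∀ {x y} → ψ.to x ≈ ψ.to y → x ≈ y
    ψ-injective {x} {y} ψx≈ψy = trans (sym (ψ.strictlyInverseʳ x)) (trans (ψ.from-cong ψx≈ψy) (ψ.strictlyInverseʳ y))
    gφφ⁻¹≈g : ∀ y → g (φ.to (φ.from y)) ≈ g y
    gφφ⁻¹≈g y = g-cong (φ.strictlyInverseˡ y)

    to : IsPermutation F f → IsPermutation F g
    to (f-injective , f-surjective) = g-injective , g-surjective
      where
      g-injective : ∀ u v → g u ≈ g v → u ≈ v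
      g-injective u v gu≈gv = begin
        u                  ≈⟨ φ.strictlyInverseˡ u ⟨
        φ.to (φ.from u)    ≈⟨ φ.to-cong (f-injective _ _ (ψ-injective (begin
          ψ.to (f (φ.from u))    ≈⟨ ψf≈gφ (φ.from u) ⟩
          g (φ.to (φ.from u))    ≈⟨ trans (gφφ⁻¹≈g u) (trans gu≈gv (sym (gφφ⁻¹≈g v))) ⟩
          g (φ.to (φ.from v))    ≈⟨ ψf≈gφ (φ.from v) ⟨
          ψ.to (f (φ.from v))    ∎))) ⟩
        φ.to (φ.from v)    ≈⟨ φ.strictlyInverseˡ v ⟩
        v                  ∎
      g-surjective : ∀ y → ∃ λ z → g z ≈ y
      g-surjective y with f-surjective (ψ.from y)
      ... | x , fx≈ψ⁻¹y = φ.to x , (begin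
        g (φ.to x)         ≈⟨ ψf≈gφ x ⟨
        ψ.to (f x)         ≈⟨ ψ.to-cong fx≈ψ⁻¹y ⟩
        ψ.to (ψ.from y)    ≈⟨ ψ.strictlyInverseˡ y ⟩
        y                  ∎)

    from : IsPermutation F g → IsPermutation F f
    from (g-injective , g-surjective) = f-injective , f-surjective
      where
      f-injective : ∀ u v → f u ≈ f v → u ≈ v
      f-injective u v fu≈fv = φ-injective (g-injective _ _ (begin
        g (φ.to u)    ≈⟨ ψf≈gφ u ⟨
        ψ.to (f u)    ≈⟨ ψ.to-cong fu≈fv ⟩
        ψ.to (f v)    ≈⟨ ψf≈gφ v ⟩
        g (φ.to v)    ∎))
      f-surjective : ∀ y → ∃ λ z → f z ≈ y
      f-surjective y with g-surjective (ψ.to y)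
      ... | z , gz≈ψy = φ.from z , ψ-injective (begin
        ψ.to (f (φ.from z))   ≈⟨ ψf≈gφ (φ.from z) ⟩
        g (φ.to (φ.from z))   ≈⟨ gφφ⁻¹≈g z ⟩
        g z                   ≈⟨ gz≈ψy ⟩
        ψ.to y                ∎)

  affineInverse : ∀ a a⁻¹ b → a * a⁻¹ ≈ 1# → Inverse setoid setoid
  affineInverse a a⁻¹ b aa⁻¹≈1 = record
    { to = to
    ; from = from
    ; to-cong = to-cong
    ; from-cong = from-cong
    ; inverse = strictlyInverseˡ⇒inverseˡ to-cong to∘from≈id , strictlyInverseʳ⇒inverseʳ from-cong from∘to≈id
    }
    where
    open import Function.Consequences.Setoid setoid setoid using (strictlyInverseˡ⇒inverseˡ; strictlyInverseʳ⇒inverseʳ)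
    to from : Carrier → Carrier
    to x = a * x + b
    from y = a⁻¹ * (y - b)
    to-cong : ∀ {x y} → x ≈ y → to x ≈ to y
    to-cong x≈y = +-congʳ (*-congˡ x≈y)
    from-cong : ∀ {x y} → x ≈ y → from x ≈ from y
    from-cong x≈y = *-congˡ (+-congʳ x≈y)
    to∘from≈id : ∀ y → to (from y) ≈ y
    to∘from≈id y = begin
      a * (a⁻¹ * (y - b)) + b   ≈⟨ solve 4 (λ a a⁻¹ y b → a :* (a⁻¹ :* (y :- b)) :+ b := (a :* a⁻¹) :* (y :- b) :+ b) refl a a⁻¹ y b ⟩
      (a * a⁻¹) * (y - b) + b   ≈⟨ +-congʳ (*-congʳ aa⁻¹≈1) ⟩
      1# * (y - b) + b          ≈⟨ solve 2 (λ y b → con (+ 1) :* (y :- b) :+ b := y) refl y b ⟩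
      y                         ∎
    from∘to≈id : ∀ x → from (to x) ≈ x
    from∘to≈id x = begin
      a⁻¹ * ((a * x + b) - b)   ≈⟨ solve 4 (λ a a⁻¹ x b → a⁻¹ :* ((a :* x :+ b) :- b) := (a :* a⁻¹) :* x) refl a a⁻¹ x b ⟩
      (a * a⁻¹) * x             ≈⟨ *-congʳ aa⁻¹≈1 ⟩
      1# * x                    ≈⟨ *-identityˡ x ⟩
      x                         ∎

  odd-char⇒two≉0 : ∀ a → HasChar F (suc (a ℕ.+ a)) → ¬ (two ≈ 0#)
  odd-char⇒two≉0 a char two≈0 = 0≉1 (sym (begin
    1#                           ≈⟨ solve 1 (λ a → con (+ 1) := con (+ 1) :+ con (+ 0) :* a) refl (natF F a) ⟩
    1# + 0# * natF F a           ≈⟨ +-congˡ (*-congʳ two≈0) ⟨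
    1# + two * natF F a          ≈⟨ solve 1 (λ a → con (+ 1) :+ con (+ 2) :* a := con (+ 1) :+ (a :+ a)) refl (natF F a) ⟩
    1# + (natF F a + natF F a)   ≈⟨ +-congˡ (natF-+ a a) ⟨
    natF F (suc (a ℕ.+ a))       ≈⟨ char ⟩
    0#                           ∎))

  D-permutation⇔Trinomial-permutation : ∀ {p} → Prime p → p ≢ 2 → HasChar F p → ∀ l k →
    IsPermutation F (D F (p ℕ.^ l ℕ.+ 2) (suc k)) ⇔ IsPermutation F (Trinomial F p l (suc k))
  D-permutation⇔Trinomial-permutation {p} p-prime p≢2 char l k with prime≢2⇒odd p-prime p≢2
  ... | a , p≡1+2a with odd^n≡odd a l
  ...   | j , [1+2a]^l≡1+2j =
    ≡.subst (λ n → IsPermutation F (D F n (suc k)) ⇔ IsPermutation F (Trinomial F p l (suc k))) (ℕ.+-comm 2 (p ℕ.^ l))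
            (IsPermutation-conjugate φ ψ (Trinomial-cong p l (suc k)) ψ∘D≈Trinomial∘φ)
    where
    p^l≡1+2j : p ℕ.^ l ≡ suc (j ℕ.+ j)
    p^l≡1+2j = ≡.trans (≡.cong (ℕ._^ l) p≡1+2a) [1+2a]^l≡1+2j

    two≉0 : ¬ (two ≈ 0#)
    two≉0 = odd-char⇒two≉0 a (≡.subst (HasChar F) p≡1+2a char)
    ½ : Carrier
    ½ = proj₁ (inverse two two≉0)
    two*½≈1 : two * ½ ≈ 1#
    two*½≈1 = proj₂ (inverse two two≉0)

    φ : Inverse setoid setoid
    φ = affineInverse (- four) (- (½ * ½)) 1# (trans
      (solve 1 (λ h → (:- con (+ 4)) :* (:- (h :* h)) := (con (+ 2) :* h) :* (con (+ 2) :* h)) refl ½)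
      (trans (*-cong two*½≈1 two*½≈1) (*-identityˡ 1#)))

    shift : Carrier
    shift = two + (1# + natF F k)
    ψ : Inverse setoid setoid
    ψ = affineInverse eight (½ * (½ * ½)) (- shift) (trans
      (solve 1 (λ h → con (+ 2) :* (con (+ 2) :* con (+ 2)) :* (h :* (h :* h))
                      := (con (+ 2) :* h) :* ((con (+ 2) :* h) :* (con (+ 2) :* h))) refl ½)
      (trans (*-cong two*½≈1 (*-cong two*½≈1 two*½≈1)) (trans (*-identityˡ _) (*-identityˡ 1#))))

    ψ∘D≈Trinomial∘φ : ∀ x → eight * D F (2 ℕ.+ p ℕ.^ l) (suc k) x + - shift ≈ Trinomial F p l (suc k) (- four * x + 1#)
    ψ∘D≈Trinomial∘φ x = begin
      eight * D F (2 ℕ.+ p ℕ.^ l) (suc k) x + - shift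
        ≈⟨ +-congʳ (Lucas.eight*D≈Trinomial x p-prime char l j p^l≡1+2j k) ⟩
      Trinomial F p l (suc k) (Lucas.t x) + shift - shift
        ≈⟨ solve 2 (λ T c → T :+ c :- c := T) refl _ shift ⟩
      Trinomial F p l (suc k) (Lucas.t x)
        ≈⟨ Trinomial-cong p l (suc k) (solve 1 (λ x → con (+ 1) :- con (+ 4) :* x := :- con (+ 4) :* x :+ con (+ 1)) refl x) ⟩
      Trinomial F p l (suc k) (- four * x + 1#) ∎

open import Data.Nat using (_+_; _^_)

theorem2p17 : ∀ {c ℓ} (F : Field c ℓ) (p q e l k : ℕ) →
    Prime p → p ≢ 2 → e ≥ 1 → q ≡ p ^ e →
    HasCard F q → HasChar F p →
    k < p → k ≢ 0 → k ≢ 2 → k ≢ 4 →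
    IsPermutation F (D F (p ^ l + 2) k) ⇔ IsPermutation F (Trinomial F p l k)
theorem2p17 F p q e l zero _ _ _ _ _ _ _ k≢0 _ _ = contradiction ≡.refl k≢0
theorem2p17 F p q e l (suc k) p-prime p≢2 _ _ _ char _ _ _ _ =
  D-permutation⇔Trinomial-permutation F p-prime p≢2 char l k
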